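{- Let $G$ be a finite graph and let $H$ be an elementary subdivision of $G$. Then $$\left\lceil \frac{2B'(G)+\delta}{3}\right\rceil\le B'(H)\le B'(G)+1,$$ where $\delta=1$ if $B'(H)$ is odd and $\delta=0$ if $B'(H)$ is even. Moreover, both bounds are sharp: each inequality holds with equality for some graph $G$ and some elementary subdivision $H$ of $G$.
   Context: Subdividing an edge $uv$ means replacing it by a path $u,w,v$ through a new vertex $w$; an elementary subdivision of $G$ is a graph obtained from $G$ by subdividing one edge. An edge-numbering of a graph $G$ is an assignment $f$ of distinct integers to the edges; $B'(f)$ is the maximum of $|f(e)-f(e')|$ over pairs of distinct incident edges $e,e'$. The edge-bandwidth $B'(G)$ is the minimum of $B'(f)$ over all edge-numberings $f$ of $G$. -}

module Defs where

open import Data.Nat using (ℕ; zero; suc; _+_; _*_; _∸_; _≤_)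
open import Data.Nat.DivMod using (_/_)
open import Data.Fin using (Fin; zero; suc; _≟_)
open import Data.Integer using (ℤ; _-_; ∣_∣)
open import Data.Product using (_×_; _,_; ∃)
open import Data.Sum using (_⊎_)
open import Relation.Nullary using (¬_; yes; no)
open import Relation.Binary.PropositionalEquality using (_≡_; _≢_)
open import Function.Definitions using (Injective)

record Graph : Set where
  field
    n   : ℕ
    m   : ℕ
    src : Fin m → Fin n
    tgt : Fin m → Fin n
open Graph public

IsSimple : Graph → Set
IsSimple G =
  (∀ e → src G e ≢ tgt G e) ×
  (∀ e e' → ((src G e ≡ src G e' × tgt G e ≡ tgt G e') ⊎
             (src G e ≡ tgt G e' × tgt G e ≡ src G e')) → e ≡ e')

Incident : (G : Graph) → Fin (m G) → Fin (m G) → Set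
Incident G e e' = e ≢ e' × ∃ λ (v : Fin (n G)) →
  ((v ≡ src G e) ⊎ (v ≡ tgt G e)) × ((v ≡ src G e') ⊎ (v ≡ tgt G e'))

record EdgeNumbering (G : Graph) : Set where
  field
    f   : Fin (m G) → ℤ
    inj : Injective _≡_ _≡_ f
open EdgeNumbering public

BwAtMost : (G : Graph) → EdgeNumbering G → ℕ → Set
BwAtMost G φ k = ∀ e e' → Incident G e e' → ∣ f φ e - f φ e' ∣ ≤ k

-- B'(f) = k : k is the maximum of |f(e)-f(e')| over incident pairs
-- (0 if there are no incident pairs)
BwOf : (G : Graph) → EdgeNumbering G → ℕ → Set
BwOf G φ k = BwAtMost G φ k × (∀ j → BwAtMost G φ j → k ≤ j)

IsEdgeBandwidth : Graph → ℕ → Set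
IsEdgeBandwidth G k =
  (∃ λ (φ : EdgeNumbering G) → BwOf G φ k) ×
  (∀ (φ : EdgeNumbering G) j → BwOf G φ j → k ≤ j)

-- Elementary subdivision of G at edge e = uv: new vertex w (= zero, old
-- vertices shifted by suc); edge e becomes uw, and a new edge wv (= zero).
subdivide : (G : Graph) → Fin (m G) → Graph
subdivide G e = record { n = suc (n G) ; m = suc (m G) ; src = s ; tgt = t }
  where
    s : Fin (suc (m G)) → Fin (suc (n G))
    s zero = zero
    s (suc i) with i ≟ e
    ... | yes _ = suc (src G e)
    ... | no _  = suc (src G i)
    t : Fin (suc (m G)) → Fin (suc (n G))
    t zero = suc (tgt G e)
    t (suc i) with i ≟ e
    ... | yes _ = zero
    ... | no _  = suc (tgt G i)

⌈_/3⌉ : ℕ → ℕ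
⌈ a /3⌉ = (a + 2) / 3

parity : ℕ → ℕ
parity zero = 0
parity (suc zero) = 1
parity (suc (suc k)) = parity k

{-# OPTIONS --safe #-}
-- Upper bound: take an optimal numbering of G, give the new half of e the number just above
-- that of e and push all larger numbers up by one; no difference grows by more than one.
-- Lower bound: take an optimal numbering of H, of bandwidth b, and let lo < hi be the numbers
-- of the two halves of e. Choose p with lo ≤ p < hi, p − lo ≤ ⌊b/2⌋ and hi − 1 − p ≤ ⌊b/2⌋,
-- delete the numbers lo and hi and close the gaps towards p, which becomes free and is given to
-- e. An edge meeting e met a half of e, so its number was within b of lo or of hi and is now
-- within b + ⌊b/2⌋ of p; differences between other edges stay at most b because hi − lo ≤ b.
-- Hence B'(G) ≤ b + ⌊b/2⌋, which rearranges to the stated lower bound. K₂ and its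
-- subdivision P₃ (bandwidths 0 and 1) attain both bounds.
module Submission where

open import Defs
open import Data.Nat as ℕ using (ℕ; zero; suc; z≤n; s≤s; ⌊_/2⌋)
import Data.Nat.Properties as ℕₚ
open import Data.Nat.DivMod using (m<n*o⇒m/o<n)
import Data.Nat.Tactic.RingSolver as ℕ-Solver
open import Data.Fin using (Fin; zero; suc; _≟_)
import Data.Fin.Properties as Finₚ
open import Data.Integer as ℤ using (ℤ; +_; -[1+_]; ∣_∣; +≤+; -≤+)
import Data.Integer.Properties as ℤₚ
open import Data.Integer.Tactic.RingSolver using (solve; solve-∀)
open import Algebra.Properties.AbelianGroup ℤₚ.+-0-abelianGroup using () renaming (∙-cancelʳ to +-cancelʳ)
open import Data.List using ([]; _∷_)
open import Data.Product using (Σ; ∃; _×_; _,_; proj₁; uncurry)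
open import Data.Sum using (_⊎_; inj₁; inj₂)
open import Data.Empty using (⊥; ⊥-elim)
open import Function using (_∘_; case_of_)
open import Relation.Nullary using (Dec; yes; no)
open import Relation.Nullary.Decidable using (_×-dec_; _⊎-dec_; _→-dec_; ¬?)
open import Relation.Binary.Definitions using (tri<; tri≈; tri>)
open import Relation.Binary.PropositionalEquality using (_≡_; _≢_; refl; sym; trans; cong; subst)

Endpoint : (G : Graph) → Fin (m G) → Fin (n G) → Set
Endpoint G x v = (v ≡ src G x) ⊎ (v ≡ tgt G x)

incident-sym : (G : Graph) {x y : Fin (m G)} → Incident G x y → Incident G y x
incident-sym G (x≢y , v , x∋v , y∋v) = x≢y ∘ sym , v , y∋v , x∋v

endpoint? : (G : Graph) → ∀ x v → Dec (Endpoint G x v)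
endpoint? G x v = (v ≟ src G x) ⊎-dec (v ≟ tgt G x)

incident? : (G : Graph) → ∀ x y → Dec (Incident G x y)
incident? G x y = ¬? (x ≟ y) ×-dec Finₚ.any? (λ v → endpoint? G x v ×-dec endpoint? G y v)

bwAtMost? : (G : Graph) (φ : EdgeNumbering G) (k : ℕ) → Dec (BwAtMost G φ k)
bwAtMost? G φ k = Finₚ.all? λ x → Finₚ.all? λ y →
  incident? G x y →-dec (∣ f φ x ℤ.- f φ y ∣ ℕ.≤? k)

bwAtMost-mono : (G : Graph) (φ : EdgeNumbering G) {j k : ℕ} →
                j ℕ.≤ k → BwAtMost G φ j → BwAtMost G φ k
bwAtMost-mono G φ j≤k bw x y inc = ℕₚ.≤-trans (bw x y inc) j≤k

least-upwardClosed : {P : ℕ → Set} → (∀ n → Dec (P n)) → (∀ {i j} → i ℕ.≤ j → P i → P j) →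
                     ∀ k → P k → ∃ λ j → j ℕ.≤ k × P j × (∀ i → P i → j ℕ.≤ i)
least-upwardClosed P? up zero p0 = zero , z≤n , p0 , λ _ _ → z≤n
least-upwardClosed P? up (suc k) pk+1 with P? k
... | yes pk = let j , j≤k , pj , least = least-upwardClosed P? up k pk
               in j , ℕₚ.m≤n⇒m≤1+n j≤k , pj , least
... | no ¬pk = suc k , ℕₚ.≤-refl , pk+1 , λ i pi → ℕₚ.≮⇒≥ λ i<k+1 → ¬pk (up (ℕₚ.≤-pred i<k+1) pi)

bwOf-≤ : (G : Graph) (φ : EdgeNumbering G) (k : ℕ) → BwAtMost G φ k → ∃ λ j → j ℕ.≤ k × BwOf G φ j
bwOf-≤ G φ = least-upwardClosed (bwAtMost? G φ) (bwAtMost-mono G φ)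

edgeBandwidth-≤ : (G : Graph) {b k : ℕ} → IsEdgeBandwidth G b →
                  (φ : EdgeNumbering G) → BwAtMost G φ k → b ℕ.≤ k
edgeBandwidth-≤ G (_ , minimal) φ bw with bwOf-≤ G φ _ bw
... | j , j≤k , bwOf = ℕₚ.≤-trans (minimal φ j bwOf) j≤k

-- In H the new vertex is zero; edge suc x is the old edge x of G, except that suc e is only the
-- half of e ending at the new vertex, and edge zero is the other, new, half.
module Subdivision (G : Graph) (e : Fin (m G)) where

  H : Graph
  H = subdivide G e

  src-old : ∀ {x} → x ≢ e → src H (suc x) ≡ suc (src G x)
  src-old {x} x≢e with x ≟ e
  ... | yes x≡e = ⊥-elim (x≢e x≡e)
  ... | no _ = refl

  tgt-old : ∀ {x} → x ≢ e → tgt H (suc x) ≡ suc (tgt G x)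
  tgt-old {x} x≢e with x ≟ e
  ... | yes x≡e = ⊥-elim (x≢e x≡e)
  ... | no _ = refl

  src-half : src H (suc e) ≡ suc (src G e)
  src-half with e ≟ e
  ... | yes _ = refl
  ... | no e≢e = ⊥-elim (e≢e refl)

  tgt-half : tgt H (suc e) ≡ zero
  tgt-half with e ≟ e
  ... | yes _ = refl
  ... | no e≢e = ⊥-elim (e≢e refl)

  endpoint-old⁻ : ∀ x v → Endpoint H (suc x) (suc v) → Endpoint G x v
  endpoint-old⁻ x v = by-cases (x ≟ e)
    where
    by-cases : Dec (x ≡ e) → Endpoint H (suc x) (suc v) → Endpoint G x v
    by-cases (yes refl) (inj₁ v≡s) = inj₁ (Finₚ.suc-injective (trans v≡s src-half))
    by-cases (yes refl) (inj₂ v≡t) with () ← trans v≡t tgt-half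
    by-cases (no x≢e) (inj₁ v≡s) = inj₁ (Finₚ.suc-injective (trans v≡s (src-old x≢e)))
    by-cases (no x≢e) (inj₂ v≡t) = inj₂ (Finₚ.suc-injective (trans v≡t (tgt-old x≢e)))

  endpoint-new⁻ : ∀ x → Endpoint H (suc x) zero → x ≡ e
  endpoint-new⁻ x = by-cases (x ≟ e)
    where
    by-cases : Dec (x ≡ e) → Endpoint H (suc x) zero → x ≡ e
    by-cases (yes x≡e) _ = x≡e
    by-cases (no x≢e) (inj₁ w≡s) with () ← trans w≡s (src-old x≢e)
    by-cases (no x≢e) (inj₂ w≡t) with () ← trans w≡t (tgt-old x≢e)

  endpoint-old : ∀ {x v} → x ≢ e → Endpoint G x v → Endpoint H (suc x) (suc v)
  endpoint-old x≢e (inj₁ v≡s) = inj₁ (trans (cong suc v≡s) (sym (src-old x≢e)))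
  endpoint-old x≢e (inj₂ v≡t) = inj₂ (trans (cong suc v≡t) (sym (tgt-old x≢e)))

  incident-old⁻ : ∀ x y → Incident H (suc x) (suc y) → Incident G x y
  incident-old⁻ x y (x≢y , zero , x∋w , y∋w) =
    ⊥-elim (x≢y (cong suc (trans (endpoint-new⁻ x x∋w) (sym (endpoint-new⁻ y y∋w)))))
  incident-old⁻ x y (x≢y , suc v , x∋v , y∋v) =
    x≢y ∘ cong suc , v , endpoint-old⁻ x v x∋v , endpoint-old⁻ y v y∋v

  incident-new⁻ : ∀ x → x ≢ e → Incident H zero (suc x) → Incident G e x
  incident-new⁻ x x≢e (_ , zero , _ , x∋w) = ⊥-elim (x≢e (endpoint-new⁻ x x∋w))
  incident-new⁻ x x≢e (_ , suc v , inj₂ v≡t , x∋v) =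
    x≢e ∘ sym , v , inj₂ (Finₚ.suc-injective v≡t) , endpoint-old⁻ x v x∋v

  incident-old : ∀ {x y} → x ≢ e → y ≢ e → Incident G x y → Incident H (suc x) (suc y)
  incident-old x≢e y≢e (x≢y , v , x∋v , y∋v) =
    x≢y ∘ Finₚ.suc-injective , suc v , endpoint-old x≢e x∋v , endpoint-old y≢e y∋v

  incident-halves : ∀ {x} → Incident G e x → Incident H (suc e) (suc x) ⊎ Incident H zero (suc x)
  incident-halves (e≢x , v , inj₁ v≡s , x∋v) =
    inj₁ ( e≢x ∘ Finₚ.suc-injective , suc v
         , inj₁ (trans (cong suc v≡s) (sym src-half)) , endpoint-old (e≢x ∘ sym) x∋v)
  incident-halves (e≢x , v , inj₂ v≡t , x∋v) =
    inj₂ ((λ ()) , suc v , inj₂ (cong suc v≡t) , endpoint-old (e≢x ∘ sym) x∋v)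

  halves-incident : Incident H zero (suc e)
  halves-incident = (λ ()) , zero , inj₁ refl , inj₂ (sym tgt-half)

module IntegerInequalities where
  open import Data.Integer using (_+_; _-_; -_; _≤_; _<_; _⊓_; _⊔_)

  infixl 6 _⊕_

  _⊕_ : ∀ {a b c d} → a ≤ b → c ≤ d → a + c ≤ b + d
  _⊕_ = ℤₚ.+-mono-≤

  -- Linear arithmetic by certificate: the hypotheses are summed into A ≤ B and
  -- the ring solver checks that the goal differs from it by a constant.
  ≤-by-certificate : ∀ {A B} X Y n → A ≤ B → Y ≡ X + (B - A) + + n → X ≤ Y
  ≤-by-certificate {A} {B} X Y n A≤B refl =
    ℤₚ.≤-trans (ℤₚ.i≤i+j X (B - A) {{ℤ.nonNegative (ℤₚ.i≤j⇒0≤j-i A≤B)}}) (ℤₚ.i≤i+j (X + (B - A)) (+ n))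

  ⊥-by-certificate : ∀ {A B} n → A ≤ B → B - A ≡ -[1+ n ] → ⊥
  ⊥-by-certificate n A≤B eq with () ← subst (+ 0 ≤_) eq (ℤₚ.i≤j⇒0≤j-i A≤B)

  <⇒+1≤ : ∀ {a b} → a < b → a + + 1 ≤ b
  <⇒+1≤ {a} a<b = subst (_≤ _) (ℤₚ.+-comm (+ 1) a) (ℤₚ.i<j⇒suc[i]≤j a<b)

  +1≤⇒< : ∀ {a b} → a + + 1 ≤ b → a < b
  +1≤⇒< {a} a+1≤b = ℤₚ.suc[i]≤j⇒i<j (subst (_≤ _) (ℤₚ.+-comm a (+ 1)) a+1≤b)

  i-j≤k⇒i≤j+k : ∀ i j k → i - j ≤ k → i ≤ j + k
  i-j≤k⇒i≤j+k i j k h = ≤-by-certificate i (j + k) 0 h (solve (i ∷ j ∷ k ∷ []))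

  i≤j+k⇒i-j≤k : ∀ i j k → i ≤ j + k → i - j ≤ k
  i≤j+k⇒i-j≤k i j k h = ≤-by-certificate (i - j) k 0 h (solve (i ∷ j ∷ k ∷ []))

  ∣i∣≤k⇒i≤k : ∀ i {k} → ∣ i ∣ ℕ.≤ k → i ≤ + k
  ∣i∣≤k⇒i≤k (+ _) ∣i∣≤k = +≤+ ∣i∣≤k
  ∣i∣≤k⇒i≤k -[1+ _ ] _ = -≤+

  i≤k∧-i≤k⇒∣i∣≤k : ∀ {i k} → i ≤ + k → - i ≤ + k → ∣ i ∣ ℕ.≤ k
  i≤k∧-i≤k⇒∣i∣≤k {+ _} (+≤+ i≤k) _ = i≤k
  i≤k∧-i≤k⇒∣i∣≤k { -[1+ _ ]} _ (+≤+ -i≤k) = -i≤k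

  ∣i-j∣≤k⇒i≤j+k : ∀ i j {k} → ∣ i - j ∣ ℕ.≤ k → i ≤ j + + k
  ∣i-j∣≤k⇒i≤j+k i j {k} h = i-j≤k⇒i≤j+k i j (+ k) (∣i∣≤k⇒i≤k (i - j) h)

  ∣i-j∣≤k⇒j≤i+k : ∀ i j {k} → ∣ i - j ∣ ℕ.≤ k → j ≤ i + + k
  ∣i-j∣≤k⇒j≤i+k i j h = ∣i-j∣≤k⇒i≤j+k j i (subst (ℕ._≤ _) (ℤₚ.∣i-j∣≡∣j-i∣ i j) h)

  i≤j+k∧j≤i+k⇒∣i-j∣≤k : ∀ {i j k} → i ≤ j + + k → j ≤ i + + k → ∣ i - j ∣ ℕ.≤ k
  i≤j+k∧j≤i+k⇒∣i-j∣≤k {i} {j} {k} h₁ h₂ = i≤k∧-i≤k⇒∣i∣≤k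
    (i≤j+k⇒i-j≤k i j (+ k) h₁)
    (j≤i+k⇒-[i-j]≤k i j (+ k) h₂)
    where
    j≤i+k⇒-[i-j]≤k : ∀ i j k → j ≤ i + k → - (i - j) ≤ k
    j≤i+k⇒-[i-j]≤k i j k h = ≤-by-certificate (- (i - j)) k 0 h (solve (i ∷ j ∷ k ∷ []))

  ∣s-t∣≤1 : ∀ {s t} → s ℕ.≤ 1 → t ℕ.≤ 1 → ∣ + s - + t ∣ ℕ.≤ 1
  ∣s-t∣≤1 z≤n z≤n = z≤n
  ∣s-t∣≤1 z≤n (s≤s z≤n) = ℕₚ.≤-refl
  ∣s-t∣≤1 (s≤s z≤n) z≤n = ℕₚ.≤-refl
  ∣s-t∣≤1 (s≤s z≤n) (s≤s z≤n) = z≤n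

  ∣[i+s]-[j+t]∣≤∣i-j∣+1 : ∀ i j {s t} → s ℕ.≤ 1 → t ℕ.≤ 1 →
                          ∣ (i + + s) - (j + + t) ∣ ℕ.≤ ∣ i - j ∣ ℕ.+ 1
  ∣[i+s]-[j+t]∣≤∣i-j∣+1 i j {s} {t} s≤1 t≤1 =
    subst (λ d → ∣ d ∣ ℕ.≤ ∣ i - j ∣ ℕ.+ 1) (sym (regroup i j (+ s) (+ t)))
      (ℕₚ.≤-trans (ℤₚ.∣i+j∣≤∣i∣+∣j∣ (i - j) (+ s - + t)) (ℕₚ.+-monoʳ-≤ ∣ i - j ∣ (∣s-t∣≤1 s≤1 t≤1)))
    where
    regroup : ∀ i j s t → (i + s) - (j + t) ≡ (i - j) + (s - t)
    regroup = solve-∀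

  <-<⇒<-1 : ∀ {a b c} → a < b → b < c → a < c - + 1
  <-<⇒<-1 {a} {b} {c} a<b b<c =
    +1≤⇒< (≤-by-certificate (a + + 1) (c - + 1) 0 (<⇒+1≤ a<b ⊕ <⇒+1≤ b<c) (solve (a ∷ b ∷ c ∷ [])))

  <⇒≤-1+k : ∀ {a b} k → + 0 ≤ k → a < b → a ≤ (b - + 1) + k
  <⇒≤-1+k {a} {b} k 0≤k a<b =
    ≤-by-certificate a ((b - + 1) + k) 0 (<⇒+1≤ a<b ⊕ 0≤k) (solve (a ∷ b ∷ k ∷ []))

  <∧≤⇒-1< : ∀ {a b c} → a < b → b - + 1 ≤ c → a - + 1 < c
  <∧≤⇒-1< {a} {b} {c} a<b b-1≤c =
    +1≤⇒< (≤-by-certificate (a - + 1 + + 1) c 0 (<⇒+1≤ a<b ⊕ b-1≤c) (solve (a ∷ b ∷ c ∷ [])))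

  -1-mono : ∀ {a} b k → a ≤ b + k → a - + 1 ≤ (b - + 1) + k
  -1-mono {a} b k a≤b+k = ≤-by-certificate (a - + 1) ((b - + 1) + k) 0 a≤b+k (solve (a ∷ b ∷ k ∷ []))

  record Midpoint (lo hi d : ℤ) : Set where
    field
      point        : ℤ
      lo≤point     : lo ≤ point
      point<hi     : point < hi
      point≤lo+d   : point ≤ lo + d
      hi≤point+1+d : hi ≤ point + + 1 + d

  midpoint : ∀ {lo hi} d → + 0 ≤ d → lo < hi → hi ≤ lo + (d + d + + 1) → Midpoint lo hi d
  midpoint {lo} {hi} d 0≤d lo<hi hi≤lo+2d+1 with (hi - + 1) ℤₚ.≤? (lo + d)
  ... | yes hi-1≤lo+d = record
    { point        = hi - + 1
    ; lo≤point     = ≤-by-certificate lo (hi - + 1) 0 (<⇒+1≤ lo<hi) (solve (lo ∷ hi ∷ []))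
    ; point<hi     = +1≤⇒< (≤-by-certificate (hi - + 1 + + 1) hi 0 (ℤₚ.≤-refl {hi}) (solve (hi ∷ [])))
    ; point≤lo+d   = hi-1≤lo+d
    ; hi≤point+1+d = ≤-by-certificate hi (hi - + 1 + + 1 + d) 0 0≤d (solve (hi ∷ d ∷ []))
    }
  ... | no hi-1≰lo+d = record
    { point        = lo + d
    ; lo≤point     = ≤-by-certificate lo (lo + d) 0 0≤d (solve (lo ∷ d ∷ []))
    ; point<hi     = +1≤⇒< (≤-by-certificate (lo + d + + 1) hi 1 (<⇒+1≤ (ℤₚ.≰⇒> hi-1≰lo+d))
                                              (solve (lo ∷ hi ∷ d ∷ [])))
    ; point≤lo+d   = ℤₚ.≤-refl
    ; hi≤point+1+d = ≤-by-certificate hi (lo + d + + 1 + d) 0 hi≤lo+2d+1 (solve (lo ∷ hi ∷ d ∷ []))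
    }

  midpoint-within : ∀ {lo hi p r k d} → p ≤ lo + d → hi ≤ p + + 1 + d → lo ≤ r + k → r + + 1 ≤ hi + k →
                   p ≤ r + (k + d) × r ≤ p + (k + d)
  midpoint-within {lo} {hi} {p} {r} {k} {d} p≤lo+d hi≤p+1+d lo≤r+k r+1≤hi+k =
    ≤-by-certificate p (r + (k + d)) 0 (p≤lo+d ⊕ lo≤r+k) (solve (p ∷ r ∷ lo ∷ k ∷ d ∷ [])) ,
    ≤-by-certificate r (p + (k + d)) 0 (r+1≤hi+k ⊕ hi≤p+1+d) (solve (p ∷ r ∷ hi ∷ k ∷ d ∷ []))

  i⊓j<i⊔j : ∀ {i j} → i ≢ j → i ⊓ j < i ⊔ j
  i⊓j<i⊔j {i} {j} i≢j with ℤₚ.≤-total i j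
  ... | inj₁ i≤j rewrite ℤₚ.i≤j⇒i⊓j≡i i≤j | ℤₚ.i≤j⇒i⊔j≡j i≤j = ℤₚ.≤∧≢⇒< i≤j i≢j
  ... | inj₂ j≤i rewrite ℤₚ.i≥j⇒i⊓j≡j j≤i | ℤₚ.i≥j⇒i⊔j≡i j≤i = ℤₚ.≤∧≢⇒< j≤i (i≢j ∘ sym)

  ∣i-j∣≤k⇒i⊔j≤i⊓j+k : ∀ i j {k} → ∣ i - j ∣ ℕ.≤ k → i ⊔ j ≤ i ⊓ j + + k
  ∣i-j∣≤k⇒i⊔j≤i⊓j+k i j ∣i-j∣≤k with ℤₚ.≤-total i j
  ... | inj₁ i≤j rewrite ℤₚ.i≤j⇒i⊓j≡i i≤j | ℤₚ.i≤j⇒i⊔j≡j i≤j = ∣i-j∣≤k⇒j≤i+k i j ∣i-j∣≤k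
  ... | inj₂ j≤i rewrite ℤₚ.i≥j⇒i⊓j≡j j≤i | ℤₚ.i≥j⇒i⊔j≡i j≤i = ∣i-j∣≤k⇒i≤j+k i j ∣i-j∣≤k

  ≢-⊓ : ∀ {v i j} → v ≢ i → v ≢ j → v ≢ i ⊓ j
  ≢-⊓ {i = i} {j} v≢i v≢j with ℤₚ.⊓-sel i j
  ... | inj₁ i⊓j≡i rewrite i⊓j≡i = v≢i
  ... | inj₂ i⊓j≡j rewrite i⊓j≡j = v≢j

  ≢-⊔ : ∀ {v i j} → v ≢ i → v ≢ j → v ≢ i ⊔ j
  ≢-⊔ {i = i} {j} v≢i v≢j with ℤₚ.⊔-sel i j
  ... | inj₁ i⊔j≡i rewrite i⊔j≡i = v≢i
  ... | inj₂ i⊔j≡j rewrite i⊔j≡j = v≢j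

  within-interval : ∀ {lo hi c v k} → lo ≤ c → c ≤ hi → ∣ c - v ∣ ℕ.≤ k → lo ≤ v + + k × v ≤ hi + + k
  within-interval {c = c} {v} lo≤c c≤hi ∣c-v∣≤k =
    ℤₚ.≤-trans lo≤c (∣i-j∣≤k⇒i≤j+k c v ∣c-v∣≤k) ,
    ℤₚ.≤-trans (∣i-j∣≤k⇒j≤i+k c v ∣c-v∣≤k) (ℤₚ.+-monoˡ-≤ _ c≤hi)

open IntegerInequalities

module InsertGap (c : ℤ) where
  open import Data.Integer using (_+_; _-_; _≤_; _<_)

  lift : ℤ → ℤ
  lift v with v ℤₚ.≤? c
  ... | yes _ = v
  ... | no _ = v + + 1

  data Lifted (v : ℤ) : ℤ → Set where
    stay : v ≤ c → Lifted v v
    step : c < v → Lifted v (v + + 1)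

  lifted : ∀ v → Lifted v (lift v)
  lifted v with v ℤₚ.≤? c
  ... | yes v≤c = stay v≤c
  ... | no v≰c = step (ℤₚ.≰⇒> v≰c)

  lift-≤1 : ∀ v → ∃ λ t → t ℕ.≤ 1 × lift v ≡ v + + t
  lift-≤1 v with lift v | lifted v
  ... | _ | stay _ = 0 , z≤n , sym (ℤₚ.+-identityʳ v)
  ... | _ | step _ = 1 , ℕₚ.≤-refl , refl

  lift-injective : ∀ {v w} → lift v ≡ lift w → v ≡ w
  lift-injective {v} {w} with lift v | lifted v | lift w | lifted w
  ... | _ | stay _ | _ | stay _ = λ v≡w → v≡w
  ... | _ | step _ | _ | step _ = +-cancelʳ (+ 1) v w
  ... | _ | stay v≤c | _ | step c<w =
    λ { refl → ⊥-elim (⊥-by-certificate 1 (<⇒+1≤ c<w ⊕ v≤c) (solve (c ∷ w ∷ []))) }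
  ... | _ | step c<v | _ | stay w≤c =
    λ { refl → ⊥-elim (⊥-by-certificate 1 (<⇒+1≤ c<v ⊕ w≤c) (solve (c ∷ v ∷ []))) }

  lift≢c+1 : ∀ v → lift v ≢ c + + 1
  lift≢c+1 v with lift v | lifted v
  ... | _ | stay v≤c = λ { refl → ⊥-by-certificate 0 v≤c (solve (c ∷ [])) }
  ... | _ | step c<v = λ v+1≡c+1 → ℤₚ.<-irrefl (sym (+-cancelʳ (+ 1) v c v+1≡c+1)) c<v

  ∣c+1-lift∣≤ : ∀ v → ∣ (c + + 1) - lift v ∣ ℕ.≤ ∣ c - v ∣ ℕ.+ 1
  ∣c+1-lift∣≤ v with lift-≤1 v
  ... | t , t≤1 , lift≡ rewrite lift≡ = ∣[i+s]-[j+t]∣≤∣i-j∣+1 c v ℕₚ.≤-refl t≤1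

  ∣lift-lift∣≤ : ∀ v w → ∣ lift v - lift w ∣ ℕ.≤ ∣ v - w ∣ ℕ.+ 1
  ∣lift-lift∣≤ v w with lift-≤1 v | lift-≤1 w
  ... | s , s≤1 , liftv≡ | t , t≤1 , liftw≡ rewrite liftv≡ | liftw≡ = ∣[i+s]-[j+t]∣≤∣i-j∣+1 v w s≤1 t≤1

module SubdivideNumbering (G : Graph) (e : Fin (m G)) (φ : EdgeNumbering G) where
  open Subdivision G e
  open InsertGap (f φ e)
  open import Data.Integer using (_+_; _-_)

  numbering-fun : Fin (m H) → ℤ
  numbering-fun zero = f φ e + + 1
  numbering-fun (suc x) = lift (f φ x)

  numbering-injective : ∀ {x y} → numbering-fun x ≡ numbering-fun y → x ≡ y
  numbering-injective {zero} {zero} _ = refl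
  numbering-injective {zero} {suc y} eq = ⊥-elim (lift≢c+1 (f φ y) (sym eq))
  numbering-injective {suc x} {zero} eq = ⊥-elim (lift≢c+1 (f φ x) eq)
  numbering-injective {suc x} {suc y} eq = cong suc (inj φ (lift-injective eq))

  numbering : EdgeNumbering H
  numbering = record { f = numbering-fun ; inj = numbering-injective }

  module _ {k : ℕ} (φ-bw : BwAtMost G φ k) where

    new-edge-bw : ∀ x → Incident H zero (suc x) → ∣ f φ e - f φ x ∣ ℕ.≤ k
    new-edge-bw x inc = by-cases (x ≟ e)
      where
      by-cases : Dec (x ≡ e) → ∣ f φ e - f φ x ∣ ℕ.≤ k
      by-cases (yes refl) = subst (ℕ._≤ k) (sym (cong ∣_∣ (ℤₚ.i≡j⇒i-j≡0 {f φ e} refl))) z≤n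
      by-cases (no x≢e) = φ-bw e x (incident-new⁻ x x≢e inc)

    numbering-bw : BwAtMost H numbering (k ℕ.+ 1)
    numbering-bw zero zero (0≢0 , _) = ⊥-elim (0≢0 refl)
    numbering-bw zero (suc x) inc =
      ℕₚ.≤-trans (∣c+1-lift∣≤ (f φ x)) (ℕₚ.+-monoˡ-≤ 1 (new-edge-bw x inc))
    numbering-bw (suc x) zero inc =
      subst (ℕ._≤ k ℕ.+ 1) (ℤₚ.∣i-j∣≡∣j-i∣ (numbering-fun zero) (numbering-fun (suc x)))
        (numbering-bw zero (suc x) (incident-sym H inc))
    numbering-bw (suc x) (suc y) inc =
      ℕₚ.≤-trans (∣lift-lift∣≤ (f φ x) (f φ y)) (ℕₚ.+-monoˡ-≤ 1 (φ-bw x y (incident-old⁻ x y inc)))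

edgeBandwidth-subdivide-≤ : (G : Graph) (e : Fin (m G)) {bG bH : ℕ} →
                            IsEdgeBandwidth G bG → IsEdgeBandwidth (subdivide G e) bH → bH ℕ.≤ bG ℕ.+ 1
edgeBandwidth-subdivide-≤ G e ((φ , φ-bw , _) , _) H-bw =
  edgeBandwidth-≤ (subdivide G e) H-bw numbering (numbering-bw φ-bw)
  where open SubdivideNumbering G e φ

module Squeeze (lo p hi k : ℤ) (lo≤p : lo ℤ.≤ p) (p<hi : p ℤ.< hi) (0≤k : + 0 ℤ.≤ k) where
  open import Data.Integer using (_+_; _-_; _≤_; _<_)

  data Region (v : ℤ) : ℤ → Set where
    below  : v < lo → Region v v
    lower  : lo < v → v ≤ p → Region v (v - + 1)
    middle : p < v → v < hi → Region v v
    above  : hi < v → Region v (v - + 1)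

  squeeze : ℤ → ℤ
  squeeze v with hi ℤₚ.<? v | lo ℤₚ.<? v | v ℤₚ.≤? p
  ... | yes _ | _     | _     = v - + 1
  ... | no _  | yes _ | yes _ = v - + 1
  ... | no _  | yes _ | no _  = v
  ... | no _  | no _  | _     = v

  region : ∀ {v} → v ≢ lo → v ≢ hi → Region v (squeeze v)
  region {v} v≢lo v≢hi with hi ℤₚ.<? v | lo ℤₚ.<? v | v ℤₚ.≤? p
  ... | yes hi<v | _        | _       = above hi<v
  ... | no _     | yes lo<v | yes v≤p = lower lo<v v≤p
  ... | no hi≮v  | yes _    | no v≰p  = middle (ℤₚ.≰⇒> v≰p) (ℤₚ.≤∧≢⇒< (ℤₚ.≮⇒≥ hi≮v) v≢hi)
  ... | no _     | no lo≮v  | _       = below (ℤₚ.≤∧≢⇒< (ℤₚ.≮⇒≥ lo≮v) v≢lo)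

  private
    lo<hi : lo < hi
    lo<hi = ℤₚ.≤-<-trans lo≤p p<hi

  region-≤ : ∀ {v r} → Region v r → r ≤ v
  region-≤ (below _)    = ℤₚ.≤-refl
  region-≤ (lower _ _)  = ℤₚ.i-j≤i _ (+ 1)
  region-≤ (middle _ _) = ℤₚ.≤-refl
  region-≤ (above _)    = ℤₚ.i-j≤i _ (+ 1)

  region-≥ : ∀ {v r} → Region v r → v - + 1 ≤ r
  region-≥ (below _)    = ℤₚ.i-j≤i _ (+ 1)
  region-≥ (lower _ _)  = ℤₚ.≤-refl
  region-≥ (middle _ _) = ℤₚ.i-j≤i _ (+ 1)
  region-≥ (above _)    = ℤₚ.≤-refl

  region-< : ∀ {v w r s} → v < w → Region v r → Region w s → r < s
  region-< v<w (lower _ _) gw = <∧≤⇒-1< v<w (region-≥ gw)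
  region-< v<w (above _) gw  = <∧≤⇒-1< v<w (region-≥ gw)
  region-< v<w (below _)      (below _)      = v<w
  region-< v<w (below _)      (middle _ _)   = v<w
  region-< v<w (middle _ _)   (below _)      = v<w
  region-< v<w (middle _ _)   (middle _ _)   = v<w
  region-< _   (below v<lo)   (lower lo<w _) = <-<⇒<-1 v<lo lo<w
  region-< _   (below v<lo)   (above hi<w)   = <-<⇒<-1 (ℤₚ.<-trans v<lo lo<hi) hi<w
  region-< _   (middle _ v<hi) (above hi<w)  = <-<⇒<-1 v<hi hi<w
  region-< v<w (middle p<v _) (lower _ w≤p)  =
    ⊥-elim (ℤₚ.<-irrefl refl (ℤₚ.<-≤-trans (ℤₚ.<-trans p<v v<w) w≤p))

  region-injective : ∀ {v w r s} → Region v r → Region w s → r ≡ s → v ≡ w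
  region-injective {v} {w} gv gw r≡s with ℤₚ.<-cmp v w
  ... | tri< v<w _ _ = ⊥-elim (ℤₚ.<-irrefl r≡s (region-< v<w gv gw))
  ... | tri≈ _ v≡w _ = v≡w
  ... | tri> _ _ w<v = ⊥-elim (ℤₚ.<-irrefl (sym r≡s) (region-< w<v gw gv))

  region-≢p : ∀ {v r} → Region v r → r ≢ p
  region-≢p (below v<lo) refl = ℤₚ.<-irrefl refl (ℤₚ.<-≤-trans v<lo lo≤p)
  region-≢p {v} (lower _ v≤p) v-1≡p =
    ⊥-by-certificate 0 (v≤p ⊕ ℤₚ.≤-reflexive (sym v-1≡p)) (solve (v ∷ p ∷ []))
  region-≢p (middle p<v _) refl = ℤₚ.<-irrefl refl p<v
  region-≢p {v} (above hi<v) v-1≡p =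
    ⊥-by-certificate 0 (<⇒+1≤ p<hi ⊕ <⇒+1≤ hi<v ⊕ ℤₚ.≤-reflexive v-1≡p) (solve (v ∷ p ∷ hi ∷ []))

  lo<v⇒lo≤r+k : ∀ {v r} → lo < v → Region v r → lo ≤ r + k
  lo<v⇒lo≤r+k {v} {r} lo<v g =
    ≤-by-certificate lo (r + k) 0 (<⇒+1≤ lo<v ⊕ region-≥ g ⊕ 0≤k) (solve (lo ∷ v ∷ r ∷ k ∷ []))

  region-lo≤ : ∀ {v r} → lo ≤ v + k → Region v r → lo ≤ r + k
  region-lo≤ lo≤v+k (below _)          = lo≤v+k
  region-lo≤ _      g@(lower lo<v _)   = lo<v⇒lo≤r+k lo<v g
  region-lo≤ _      g@(middle p<v _)   = lo<v⇒lo≤r+k (ℤₚ.≤-<-trans lo≤p p<v) g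
  region-lo≤ _      g@(above hi<v)     = lo<v⇒lo≤r+k (ℤₚ.<-trans lo<hi hi<v) g

  v<hi⇒r+1≤hi+k : ∀ {v r} → v < hi → Region v r → r + + 1 ≤ hi + k
  v<hi⇒r+1≤hi+k {v} {r} v<hi g =
    ≤-by-certificate (r + + 1) (hi + k) 0 (region-≤ g ⊕ <⇒+1≤ v<hi ⊕ 0≤k) (solve (v ∷ r ∷ hi ∷ k ∷ []))

  region-≤hi : ∀ {v r} → v ≤ hi + k → Region v r → r + + 1 ≤ hi + k
  region-≤hi _      g@(below v<lo)     = v<hi⇒r+1≤hi+k (ℤₚ.<-trans v<lo lo<hi) g
  region-≤hi _      g@(lower _ v≤p)    = v<hi⇒r+1≤hi+k (ℤₚ.≤-<-trans v≤p p<hi) g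
  region-≤hi _      g@(middle _ v<hi)  = v<hi⇒r+1≤hi+k v<hi g
  region-≤hi {v} v≤hi+k (above _)      =
    ≤-by-certificate (v - + 1 + + 1) (hi + k) 0 v≤hi+k (solve (v ∷ hi ∷ k ∷ []))

  -- Only a middle value and a lower one move apart, by one, and they were less than hi − lo ≤ k apart.
  region-pair : hi ≤ lo + k → ∀ {v w r s} → v ≤ w + k → Region v r → Region w s → r ≤ s + k
  region-pair _ v≤w+k gv (below _)    = ℤₚ.≤-trans (region-≤ gv) v≤w+k
  region-pair _ v≤w+k gv (middle _ _) = ℤₚ.≤-trans (region-≤ gv) v≤w+k
  region-pair _ {w = w} v≤w+k (lower _ _) (lower _ _) = -1-mono w k v≤w+k
  region-pair _ {w = w} v≤w+k (lower _ _) (above _)   = -1-mono w k v≤w+k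
  region-pair _ {w = w} v≤w+k (above _)   (lower _ _) = -1-mono w k v≤w+k
  region-pair _ {w = w} v≤w+k (above _)   (above _)   = -1-mono w k v≤w+k
  region-pair _ _ (below v<lo)    (lower lo<w _) = <⇒≤-1+k k 0≤k (ℤₚ.<-trans v<lo lo<w)
  region-pair _ _ (below v<lo)    (above hi<w)   = <⇒≤-1+k k 0≤k (ℤₚ.<-trans (ℤₚ.<-trans v<lo lo<hi) hi<w)
  region-pair _ _ (middle _ v<hi) (above hi<w)   = <⇒≤-1+k k 0≤k (ℤₚ.<-trans v<hi hi<w)
  region-pair hi≤lo+k {v} {w} _ (middle _ v<hi) (lower lo<w _) =
    ≤-by-certificate v ((w - + 1) + k) 1 (<⇒+1≤ v<hi ⊕ hi≤lo+k ⊕ <⇒+1≤ lo<w)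
                     (solve (v ∷ w ∷ lo ∷ hi ∷ k ∷ []))

⌊n/2⌋+⌊n/2⌋+parity≡n : ∀ n → ⌊ n /2⌋ ℕ.+ ⌊ n /2⌋ ℕ.+ parity n ≡ n
⌊n/2⌋+⌊n/2⌋+parity≡n zero = refl
⌊n/2⌋+⌊n/2⌋+parity≡n (suc zero) = refl
⌊n/2⌋+⌊n/2⌋+parity≡n (suc (suc n)) rewrite ℕₚ.+-suc ⌊ n /2⌋ ⌊ n /2⌋ =
  cong (λ k → suc (suc k)) (⌊n/2⌋+⌊n/2⌋+parity≡n n)

parity≤1 : ∀ n → parity n ℕ.≤ 1
parity≤1 zero = z≤n
parity≤1 (suc zero) = ℕₚ.≤-refl
parity≤1 (suc (suc n)) = parity≤1 n

n≤⌊n/2⌋+⌊n/2⌋+1 : ∀ n → n ℕ.≤ ⌊ n /2⌋ ℕ.+ ⌊ n /2⌋ ℕ.+ 1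
n≤⌊n/2⌋+⌊n/2⌋+1 n = subst (ℕ._≤ ⌊ n /2⌋ ℕ.+ ⌊ n /2⌋ ℕ.+ 1) (⌊n/2⌋+⌊n/2⌋+parity≡n n)
                           (ℕₚ.+-monoʳ-≤ (⌊ n /2⌋ ℕ.+ ⌊ n /2⌋) (parity≤1 n))

module Contraction (G : Graph) (e : Fin (m G)) (ψ : EdgeNumbering (subdivide G e))
                   {b : ℕ} (ψ-bw : BwAtMost (subdivide G e) ψ b) where
  open Subdivision G e
  open import Data.Integer using (_+_; _-_; _≤_; _<_; _⊓_; _⊔_)

  old : Fin (m G) → ℤ
  old x = f ψ (suc x)

  a c lo hi : ℤ
  a = f ψ (suc e)
  c = f ψ zero
  lo = a ⊓ c
  hi = a ⊔ c

  lo<hi : lo < hi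
  lo<hi = i⊓j<i⊔j λ a≡c → case inj ψ a≡c of λ ()

  hi≤lo+b : hi ≤ lo + + b
  hi≤lo+b = ∣i-j∣≤k⇒i⊔j≤i⊓j+k a c (ψ-bw (suc e) zero (incident-sym H halves-incident))

  old-avoids : ∀ {x} → x ≢ e → old x ≢ lo × old x ≢ hi
  old-avoids {x} x≢e = ≢-⊓ old≢a old≢c , ≢-⊔ old≢a old≢c
    where
    old≢a : old x ≢ a
    old≢a = x≢e ∘ Finₚ.suc-injective ∘ inj ψ
    old≢c : old x ≢ c
    old≢c old≡c with () ← inj ψ old≡c

  old-near : ∀ {x} → Incident G e x → lo ≤ old x + + b × old x ≤ hi + + b
  old-near {x} inc with incident-halves inc
  ... | inj₁ inc-a = within-interval (ℤₚ.i⊓j≤i a c) (ℤₚ.i≤i⊔j a c) (ψ-bw (suc e) (suc x) inc-a)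
  ... | inj₂ inc-c = within-interval (ℤₚ.i⊓j≤j a c) (ℤₚ.i≤j⊔i a c) (ψ-bw zero (suc x) inc-c)

  d : ℕ
  d = ⌊ b /2⌋

  mid : Midpoint lo hi (+ d)
  mid = midpoint (+ d) (+≤+ z≤n) lo<hi (ℤₚ.≤-trans hi≤lo+b (ℤₚ.+-monoʳ-≤ lo (+≤+ (n≤⌊n/2⌋+⌊n/2⌋+1 b))))

  open Midpoint mid renaming (point to p)
  open Squeeze lo p hi (+ b) lo≤point point<hi (+≤+ z≤n)

  numbering-fun : Fin (m G) → ℤ
  numbering-fun x with x ≟ e
  ... | yes _ = p
  ... | no _ = squeeze (old x)

  data Value (x : Fin (m G)) : ℤ → Set where
    contracted : x ≡ e → Value x p
    squeezed   : ∀ {r} → x ≢ e → Region (old x) r → Value x r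

  value : ∀ x → Value x (numbering-fun x)
  value x with x ≟ e
  ... | yes x≡e = contracted x≡e
  ... | no x≢e = squeezed x≢e (uncurry region (old-avoids x≢e))

  value-injective : ∀ {x y r s} → Value x r → Value y s → r ≡ s → x ≡ y
  value-injective (contracted x≡e) (contracted y≡e) _ = trans x≡e (sym y≡e)
  value-injective (contracted _) (squeezed _ gy) p≡s = ⊥-elim (region-≢p gy (sym p≡s))
  value-injective (squeezed _ gx) (contracted _) r≡p = ⊥-elim (region-≢p gx r≡p)
  value-injective (squeezed _ gx) (squeezed _ gy) r≡s =
    Finₚ.suc-injective (inj ψ (region-injective gx gy r≡s))

  numbering : EdgeNumbering G
  numbering = record { f = numbering-fun ; inj = λ {x} {y} → value-injective (value x) (value y) }

  contracted-bw : ∀ {y r} → Incident G e y → Region (old y) r → ∣ p - r ∣ ℕ.≤ b ℕ.+ d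
  contracted-bw inc gy =
    let lo≤y+b , y≤hi+b = old-near inc
        p≤r+b+d , r≤p+b+d =
          midpoint-within point≤lo+d hi≤point+1+d (region-lo≤ lo≤y+b gy) (region-≤hi y≤hi+b gy)
    in i≤j+k∧j≤i+k⇒∣i-j∣≤k p≤r+b+d r≤p+b+d

  squeezed-bw : ∀ {x y r s} → Incident G x y → x ≢ e → y ≢ e →
                Region (old x) r → Region (old y) s → ∣ r - s ∣ ℕ.≤ b
  squeezed-bw {x} {y} inc x≢e y≢e gx gy =
    i≤j+k∧j≤i+k⇒∣i-j∣≤k (region-pair hi≤lo+b (∣i-j∣≤k⇒i≤j+k (old x) (old y) ∣x-y∣≤b) gx gy)
                        (region-pair hi≤lo+b (∣i-j∣≤k⇒j≤i+k (old x) (old y) ∣x-y∣≤b) gy gx)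
    where
    ∣x-y∣≤b : ∣ old x - old y ∣ ℕ.≤ b
    ∣x-y∣≤b = ψ-bw (suc x) (suc y) (incident-old x≢e y≢e inc)

  values-bw : ∀ {x y r s} → Incident G x y → Value x r → Value y s → ∣ r - s ∣ ℕ.≤ b ℕ.+ d
  values-bw (x≢y , _) (contracted refl) (contracted refl) = ⊥-elim (x≢y refl)
  values-bw inc (contracted refl) (squeezed _ gy) = contracted-bw inc gy
  values-bw {r = r} inc (squeezed _ gx) (contracted refl) =
    subst (ℕ._≤ b ℕ.+ d) (ℤₚ.∣i-j∣≡∣j-i∣ p r) (contracted-bw (incident-sym G inc) gx)
  values-bw inc (squeezed x≢e gx) (squeezed y≢e gy) =
    ℕₚ.≤-trans (squeezed-bw inc x≢e y≢e gx gy) (ℕₚ.m≤m+n b d)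

  numbering-bw : BwAtMost G numbering (b ℕ.+ ⌊ b /2⌋)
  numbering-bw x y inc = values-bw inc (value x) (value y)

edgeBandwidth-subdivide-≥ : (G : Graph) (e : Fin (m G)) {bG bH : ℕ} →
                            IsEdgeBandwidth G bG → IsEdgeBandwidth (subdivide G e) bH →
                            bG ℕ.≤ bH ℕ.+ ⌊ bH /2⌋
edgeBandwidth-subdivide-≥ G e G-bw ((ψ , ψ-bw , _) , _) = edgeBandwidth-≤ G G-bw numbering numbering-bw
  where open Contraction G e ψ ψ-bw

-- Opened only now: the modules above open ℤ's operators of the same names locally.
open import Data.Nat using (_+_; _*_; _≤_)

⌈2m+parity/3⌉≤n : ∀ {m n} → m ≤ n + ⌊ n /2⌋ → ⌈ 2 * m + parity n /3⌉ ≤ n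
⌈2m+parity/3⌉≤n {m} {n} m≤n+⌊n/2⌋ = ℕₚ.≤-pred (m<n*o⇒m/o<n (begin-strict
  2 * m + parity n + 2 <⟨ ℕₚ.+-monoʳ-< (2 * m + parity n) (ℕₚ.n<1+n 2) ⟩
  2 * m + parity n + 3 ≤⟨ ℕₚ.+-monoˡ-≤ 3 2m+parity≤3n ⟩
  n * 3 + 3            ≡⟨ ℕₚ.+-comm (n * 3) 3 ⟩
  suc n * 3            ∎))
  where
  open ℕₚ.≤-Reasoning
  regroup : ∀ n h q → 2 * (n + h) + q ≡ n + n + (h + h + q)
  regroup = ℕ-Solver.solve-∀
  triple : ∀ n → n + n + n ≡ n * 3
  triple = ℕ-Solver.solve-∀
  2m+parity≤3n : 2 * m + parity n ≤ n * 3
  2m+parity≤3n = begin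
    2 * m + parity n                       ≤⟨ ℕₚ.+-monoˡ-≤ (parity n) (ℕₚ.*-monoʳ-≤ 2 m≤n+⌊n/2⌋) ⟩
    2 * (n + ⌊ n /2⌋) + parity n           ≡⟨ regroup n ⌊ n /2⌋ (parity n) ⟩
    n + n + (⌊ n /2⌋ + ⌊ n /2⌋ + parity n) ≡⟨ cong (λ q → n + n + q) (⌊n/2⌋+⌊n/2⌋+parity≡n n) ⟩
    n + n + n                              ≡⟨ triple n ⟩
    n * 3                                  ∎

K₂ : Graph
K₂ = record { n = 2 ; m = 1 ; src = λ _ → zero ; tgt = λ _ → suc zero }

K₂-simple : IsSimple K₂
K₂-simple = (λ _ ()) , λ { zero zero _ → refl }

K₂-numbering : EdgeNumbering K₂
K₂-numbering = record { f = λ _ → + 0 ; inj = λ { {zero} {zero} _ → refl } }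

K₂-bw : BwAtMost K₂ K₂-numbering 0
K₂-bw zero zero (0≢0 , _) = ⊥-elim (0≢0 refl)

K₂-edgeBandwidth : IsEdgeBandwidth K₂ 0
K₂-edgeBandwidth = (K₂-numbering , K₂-bw , λ _ _ → z≤n) , λ _ _ _ → z≤n

incident⇒1≤bw : (G : Graph) (φ : EdgeNumbering G) {k : ℕ} {x y : Fin (m G)} →
                Incident G x y → BwAtMost G φ k → 1 ≤ k
incident⇒1≤bw G φ {x = x} {y} inc bw = ℕₚ.≤-trans 1≤∣φx-φy∣ (bw x y inc)
  where
  1≤∣φx-φy∣ : 1 ≤ ∣ f φ x ℤ.- f φ y ∣
  1≤∣φx-φy∣ with ∣ f φ x ℤ.- f φ y ∣ in eq
  ... | zero = ⊥-elim (proj₁ inc (inj φ (ℤₚ.i-j≡0⇒i≡j (f φ x) (f φ y) (ℤₚ.∣i∣≡0⇒i≡0 eq))))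
  ... | suc _ = s≤s z≤n

P₃-edgeBandwidth : IsEdgeBandwidth (subdivide K₂ zero) 1
P₃-edgeBandwidth =
  (numbering , numbering-bw K₂-bw , λ _ bw → incident⇒1≤bw P₃ numbering halves-incident bw) ,
  λ φ _ (bw , _) → incident⇒1≤bw P₃ φ halves-incident bw
  where
  open Subdivision K₂ zero renaming (H to P₃)
  open SubdivideNumbering K₂ zero K₂-numbering

theorem11 : ((G : Graph) → IsSimple G → (e : Fin (m G)) → (bG bH : ℕ) →
               IsEdgeBandwidth G bG → IsEdgeBandwidth (subdivide G e) bH →
               (⌈ 2 * bG + parity bH /3⌉ ≤ bH) × (bH ≤ bG + 1))
            × (Σ Graph λ G → IsSimple G × Σ (Fin (m G)) λ e → ∃ λ bG → ∃ λ bH →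
               IsEdgeBandwidth G bG × IsEdgeBandwidth (subdivide G e) bH ×
               (⌈ 2 * bG + parity bH /3⌉ ≡ bH))
            × (Σ Graph λ G → IsSimple G × Σ (Fin (m G)) λ e → ∃ λ bG → ∃ λ bH →
               IsEdgeBandwidth G bG × IsEdgeBandwidth (subdivide G e) bH ×
               (bH ≡ bG + 1))
theorem11 =
  (λ G _ e bG bH G-bw H-bw →
     ⌈2m+parity/3⌉≤n (edgeBandwidth-subdivide-≥ G e G-bw H-bw) ,
     edgeBandwidth-subdivide-≤ G e G-bw H-bw) ,
  (K₂ , K₂-simple , zero , 0 , 1 , K₂-edgeBandwidth , P₃-edgeBandwidth , refl) ,
  (K₂ , K₂-simple , zero , 0 , 1 , K₂-edgeBandwidth , P₃-edgeBandwidth , refl)
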